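{- For any two permutations $\pi,\rho$ of rank $n$, \[\operatorname{ninvsum}(\pi\circ\rho)=\pi\cdot\rho^{\mathrm{i}}-\mathbf{1}\cdot\mathbf{1}^{\mathrm{c}}.\]
   Context: Permutations of rank $n$ are bijections of $\{1,\dots,n\}$, viewed also as vectors $(\pi(1),\dots,\pi(n))$; for two such, $\pi\cdot\sigma=\sum_{i=1}^n\pi(i)\sigma(i)$ is the dot product. $(\pi\circ\rho)(i)=\pi(\rho(i))$, $\rho^{\mathrm{i}}$ is the inverse of $\rho$, $\mathbf{1}=12\cdots n$ is the identity and $\mathbf{1}^{\mathrm{c}}=n(n-1)\cdots1$. A non-inversion of $\sigma$ is a pair $(a,b)$ with $1\le a<b\le n$ and $\sigma(a)<\sigma(b)$, and $\operatorname{ninvsum}(\sigma)$ is the sum of $b-a$ over all non-inversions $(a,b)$ of $\sigma$. -}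

module Defs where

open import Data.Nat using (ℕ; zero; suc; _+_; _*_; _∸_; _<_)
open import Data.Nat.Properties using (_<?_)
open import Data.Fin using (Fin; toℕ; fromℕ; opposite)
import Data.Fin as F
open import Data.Fin.Permutation using (Permutation′; _⟨$⟩ʳ_; _⟨$⟩ˡ_)
open import Relation.Nullary using (does)
open import Data.Bool using (if_then_else_)

sumFin : ∀ {n} → (Fin n → ℕ) → ℕ
sumFin {zero}  f = 0
sumFin {suc n} f = f F.zero + sumFin (λ i → f (F.suc i))

-- a permutation of rank n viewed as a function {1..n} → {1..n}:
-- position i (Fin n, 0-based) has 1-based value  val π i = toℕ (π i) + 1
val : ∀ {n} → (Fin n → Fin n) → Fin n → ℕ
val σ i = suc (toℕ (σ i))

dot : ∀ {n} → (Fin n → Fin n) → (Fin n → Fin n) → ℕ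
dot π σ = sumFin (λ i → val π i * val σ i)

compose : ∀ {n} → Permutation′ n → Permutation′ n → (Fin n → Fin n)
compose π ρ i = π ⟨$⟩ʳ (ρ ⟨$⟩ʳ i)

inv : ∀ {n} → Permutation′ n → (Fin n → Fin n)
inv ρ i = ρ ⟨$⟩ˡ i

one : ∀ {n} → Fin n → Fin n
one i = i

oneᶜ : ∀ {n} → Fin n → Fin n
oneᶜ i = opposite i

ninvsum : ∀ {n} → (Fin n → Fin n) → ℕ
ninvsum σ = sumFin (λ a → sumFin (λ b →
  if does (toℕ a <? toℕ b) then
    (if does (toℕ (σ a) <? toℕ (σ b)) then toℕ b ∸ toℕ a else 0)
  else 0))

fun : ∀ {n} → Permutation′ n → (Fin n → Fin n)
fun π i = π ⟨$⟩ʳ i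

-- In 1-based terms, σ(j) = 1 + #{a | σ(a) < σ(j)}, hence σ·1 = Σ_j j + Σ_{σ(a)<σ(b)} b.
-- Group the pairs of the last sum by their smaller position a < b: a non-inversion
-- contributes b = (b − a) + a and an inversion contributes a. So
-- σ·1 = ninvsum σ + Σ_j j + Σ_{a<b} a = ninvsum σ + Σ_a a (n − a + 1) = ninvsum σ + 1·1ᶜ.
-- The corollary is the case σ = π ∘ ρ, since reindexing by ρ gives π·ρⁱ = (π ∘ ρ)·1.
module Submission where

open import Defs
open import Data.Nat using (ℕ; zero; suc; _+_; _*_; _∸_; _<_; _≤_; s≤s)
open import Data.Nat.Properties
open import Data.Integer using (+_; _-_)
open import Data.Integer.Properties using (+-0-abelianGroup)
open import Algebra.Properties.AbelianGroup +-0-abelianGroup using (xyx⁻¹≈y)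
open import Algebra.Properties.Semiring.Sum +-*-semiring
  using (sum; sum-syntax; sum-cong-≗; sum-replicate-zero; ∑-distrib-+; ∑-comm; ∑-permute)
open import Data.Fin using (Fin; toℕ; opposite)
import Data.Fin as F
open import Data.Fin.Properties using (toℕ-injective; toℕ<n; opposite-prop)
open import Data.Fin.Permutation using (Permutation′; _⟨$⟩ʳ_; _⟨$⟩ˡ_; _∘ₚ_; inverseˡ)
open import Function.Bundles using (Injection)
open import Function.Properties.Inverse using (↔⇒↣)
open import Data.Bool using (if_then_else_)
open import Relation.Nullary using (¬_; does; yes; no; contradiction)
open import Relation.Nullary.Decidable using (dec-true; dec-false)
open import Relation.Binary.Definitions using (tri<; tri≈; tri>)
open import Relation.Binary.PropositionalEquality
  using (_≡_; _≢_; refl; sym; trans; cong; cong₂; subst; module ≡-Reasoning)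
open import Function using (_∘_)

sumFin≡sum : ∀ {n} (f : Fin n → ℕ) → sumFin f ≡ sum f
sumFin≡sum {zero}  f = refl
sumFin≡sum {suc n} f = cong (_+_ (f F.zero)) (sumFin≡sum (λ i → f (F.suc i)))

∑-const : ∀ n c → ∑[ i < n ] c ≡ n * c
∑-const zero    c = refl
∑-const (suc n) c = cong (_+_ c) (∑-const n c)

∑∑-split : ∀ {m n} {f g h : Fin m → Fin n → ℕ} → (∀ a b → f a b ≡ g a b + h a b) →
  ∑[ a < m ] ∑[ b < n ] f a b ≡ ∑[ a < m ] ∑[ b < n ] g a b + ∑[ a < m ] ∑[ b < n ] h a b
∑∑-split {n = n} {g = g} {h} f≡g+h =
  trans (sum-cong-≗ (λ a → trans (sum-cong-≗ (f≡g+h a)) (∑-distrib-+ (g a) (h a))))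
        (∑-distrib-+ (λ a → ∑[ b < n ] g a b) (λ a → ∑[ b < n ] h a b))

infixr 10 [_<_]·_

[_<_]·_ : ℕ → ℕ → ℕ → ℕ
[ x < y ]· c = if does (x <? y) then c else 0

[<]·-yes : ∀ {x y} c → x < y → [ x < y ]· c ≡ c
[<]·-yes {x} {y} c x<y = cong (λ b → if b then c else 0) (dec-true (x <? y) x<y)

[<]·-no : ∀ {x y} c → ¬ x < y → [ x < y ]· c ≡ 0
[<]·-no {x} {y} c x≮y = cong (λ b → if b then c else 0) (dec-false (x <? y) x≮y)

[<]·-irrefl : ∀ x c → [ x < x ]· c ≡ 0
[<]·-irrefl x c = [<]·-no {x} c (<-irrefl refl)

[<]·-cong : ∀ {x y c d} → (x < y → c ≡ d) → [ x < y ]· c ≡ [ x < y ]· d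
[<]·-cong {x} {y} {c} {d} c≡d with x <? y
... | yes x<y = trans ([<]·-yes c x<y) (trans (c≡d x<y) (sym ([<]·-yes d x<y)))
... | no x≮y  = trans ([<]·-no c x≮y) (sym ([<]·-no d x≮y))

[<]·-distrib-+ : ∀ x y c d → [ x < y ]· (c + d) ≡ [ x < y ]· c + [ x < y ]· d
[<]·-distrib-+ x y c d with x <? y
... | yes x<y = trans ([<]·-yes _ x<y) (sym (cong₂ _+_ ([<]·-yes c x<y) ([<]·-yes d x<y)))
... | no x≮y  = trans ([<]·-no _ x≮y) (sym (cong₂ _+_ ([<]·-no c x≮y) ([<]·-no d x≮y)))

∑-[<]·-below : ∀ {n} v c → v ≤ n → ∑[ a < n ] [ toℕ a < v ]· c ≡ v * c
∑-[<]·-below {n}     zero    c _           = sum-replicate-zero n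
∑-[<]·-below {suc n} (suc v) c (s≤s v≤n) = cong (_+_ c) (∑-[<]·-below v c v≤n)

∑-[<]·-above : ∀ n k c → ∑[ b < n ] [ k < toℕ b ]· c ≡ (n ∸ suc k) * c
∑-[<]·-above zero    k       c = refl
∑-[<]·-above (suc n) zero    c = ∑-const n c
∑-[<]·-above (suc n) (suc k) c = ∑-[<]·-above n k c

∑∑-symmetrise : ∀ {n} (f : Fin n → Fin n → ℕ) → (∀ a → f a a ≡ 0) →
  ∑[ a < n ] ∑[ b < n ] f a b ≡ ∑[ a < n ] ∑[ b < n ] [ toℕ a < toℕ b ]· (f a b + f b a)
∑∑-symmetrise {n} f f-diag = begin
  ∑[ a < n ] ∑[ b < n ] f a b
    ≡⟨ ∑∑-split {n} {n} split-diagonal ⟩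
  ∑[ a < n ] ∑[ b < n ] [ toℕ a < toℕ b ]· f a b + ∑[ a < n ] ∑[ b < n ] [ toℕ b < toℕ a ]· f a b
    ≡⟨ cong (_+_ _) (∑-comm (λ a b → [ toℕ b < toℕ a ]· f a b)) ⟩
  ∑[ a < n ] ∑[ b < n ] [ toℕ a < toℕ b ]· f a b + ∑[ a < n ] ∑[ b < n ] [ toℕ a < toℕ b ]· f b a
    ≡⟨ ∑∑-split {n} {n} (λ a b → [<]·-distrib-+ (toℕ a) (toℕ b) (f a b) (f b a)) ⟨
  ∑[ a < n ] ∑[ b < n ] [ toℕ a < toℕ b ]· (f a b + f b a)
    ∎
  where
  open ≡-Reasoning
  split-diagonal : ∀ a b → f a b ≡ [ toℕ a < toℕ b ]· f a b + [ toℕ b < toℕ a ]· f a b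
  split-diagonal a b with <-cmp (toℕ a) (toℕ b)
  ... | tri< a<b _ b≮a = sym (trans (cong₂ _+_ ([<]·-yes _ a<b) ([<]·-no _ b≮a)) (+-identityʳ _))
  ... | tri≈ a≮b a≡b b≮a = trans (subst (λ b → f a b ≡ 0) (toℕ-injective a≡b) (f-diag a))
                                  (sym (cong₂ _+_ ([<]·-no _ a≮b) ([<]·-no _ b≮a)))
  ... | tri> a≮b _ b<a = sym (cong₂ _+_ ([<]·-no _ a≮b) ([<]·-yes _ b<a))

pair-weight : ∀ {x y u v} → x < y → u ≢ v →
  [ u < v ]· suc y + [ v < u ]· suc x ≡ [ u < v ]· (y ∸ x) + suc x
pair-weight {x} {y} {u} {v} x<y u≢v with <-cmp u v
... | tri< u<v _ v≮u = begin
  [ u < v ]· suc y + [ v < u ]· suc x ≡⟨ cong₂ _+_ ([<]·-yes _ u<v) ([<]·-no _ v≮u) ⟩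
  suc y + 0                           ≡⟨ +-identityʳ (suc y) ⟩
  suc y                               ≡⟨ cong suc (m∸n+n≡m (<⇒≤ x<y)) ⟨
  suc (y ∸ x + x)                     ≡⟨ +-suc (y ∸ x) x ⟨
  y ∸ x + suc x                       ≡⟨ cong (_+ suc x) ([<]·-yes _ u<v) ⟨
  [ u < v ]· (y ∸ x) + suc x          ∎
  where open ≡-Reasoning
... | tri≈ _ u≡v _ = contradiction u≡v u≢v
... | tri> u≮v _ v<u = trans (cong₂ _+_ ([<]·-no _ u≮v) ([<]·-yes _ v<u))
                             (sym (cong (_+ suc x) ([<]·-no _ u≮v)))

ninvsum≡∑∑ : ∀ {n} (σ : Fin n → Fin n) → ninvsum σ ≡
  ∑[ a < n ] ∑[ b < n ] [ toℕ a < toℕ b ]· [ toℕ (σ a) < toℕ (σ b) ]· (toℕ b ∸ toℕ a)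
ninvsum≡∑∑ {n} σ =
  trans (sumFin≡sum (λ a → sumFin (w a))) (sum-cong-≗ (λ a → sumFin≡sum (w a)))
  where
  w : Fin n → Fin n → ℕ
  w a b = [ toℕ a < toℕ b ]· [ toℕ (σ a) < toℕ (σ b) ]· (toℕ b ∸ toℕ a)

dot-one-oneᶜ : ∀ n → dot (one {n}) oneᶜ ≡
  ∑[ a < n ] suc (toℕ a) + ∑[ a < n ] ((n ∸ suc (toℕ a)) * suc (toℕ a))
dot-one-oneᶜ n = trans (sumFin≡sum {n} _) (trans (sum-cong-≗ term) (∑-distrib-+ {n} _ _))
  where
  term : ∀ a → suc (toℕ a) * suc (toℕ (opposite a)) ≡
               suc (toℕ a) + (n ∸ suc (toℕ a)) * suc (toℕ a)
  term a rewrite opposite-prop {n} a =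
    trans (*-suc (suc (toℕ a)) _) (cong (_+_ (suc (toℕ a))) (*-comm (suc (toℕ a)) _))

module _ {n} (σ : Permutation′ n) where

  private
    s : Fin n → ℕ
    s i = toℕ (σ ⟨$⟩ʳ i)

  rank-count : ∀ j c → ∑[ a < n ] [ s a < s j ]· c ≡ s j * c
  rank-count j c = trans (sym (∑-permute (λ b → [ toℕ b < s j ]· c) σ))
                         (∑-[<]·-below (s j) c (<⇒≤ (toℕ<n (σ ⟨$⟩ʳ j))))

  s-injective : ∀ {a b} → s a ≡ s b → a ≡ b
  s-injective = Injection.injective (↔⇒↣ σ) ∘ toℕ-injective

  ∑∑-rank-weight : ∑[ a < n ] ∑[ b < n ] [ s a < s b ]· suc (toℕ b) ≡
    ninvsum (fun σ) + ∑[ a < n ] ((n ∸ suc (toℕ a)) * suc (toℕ a))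
  ∑∑-rank-weight = begin
    ∑[ a < n ] ∑[ b < n ] [ s a < s b ]· suc (toℕ b)
      ≡⟨ ∑∑-symmetrise (λ a b → [ s a < s b ]· suc (toℕ b)) (λ a → [<]·-irrefl (s a) _) ⟩
    ∑[ a < n ] ∑[ b < n ] [ toℕ a < toℕ b ]·
      ([ s a < s b ]· suc (toℕ b) + [ s b < s a ]· suc (toℕ a))
      ≡⟨ ∑∑-split {n} {n} by-pair-weight ⟩
    ∑[ a < n ] ∑[ b < n ] [ toℕ a < toℕ b ]· [ s a < s b ]· (toℕ b ∸ toℕ a)
      + ∑[ a < n ] ∑[ b < n ] [ toℕ a < toℕ b ]· suc (toℕ a)
      ≡⟨ cong₂ _+_ (sym (ninvsum≡∑∑ (fun σ)))
                   (sum-cong-≗ {n} (λ a → ∑-[<]·-above n (toℕ a) (suc (toℕ a)))) ⟩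
    ninvsum (fun σ) + ∑[ a < n ] ((n ∸ suc (toℕ a)) * suc (toℕ a))
      ∎
    where
    open ≡-Reasoning
    by-pair-weight : ∀ a b →
      [ toℕ a < toℕ b ]· ([ s a < s b ]· suc (toℕ b) + [ s b < s a ]· suc (toℕ a)) ≡
      [ toℕ a < toℕ b ]· [ s a < s b ]· (toℕ b ∸ toℕ a) + [ toℕ a < toℕ b ]· suc (toℕ a)
    by-pair-weight a b = trans ([<]·-cong (λ a<b → pair-weight a<b (s-distinct a<b)))
                               ([<]·-distrib-+ (toℕ a) (toℕ b) _ _)
      where
      s-distinct : toℕ a < toℕ b → s a ≢ s b
      s-distinct a<b sa≡sb = <-irrefl (cong toℕ (s-injective sa≡sb)) a<b

  dot-one≡dot-one-oneᶜ+ninvsum : dot (fun σ) one ≡ dot (one {n}) oneᶜ + ninvsum (fun σ)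
  dot-one≡dot-one-oneᶜ+ninvsum = begin
    dot (fun σ) one
      ≡⟨ sumFin≡sum (λ j → suc (s j) * suc (toℕ j)) ⟩
    ∑[ j < n ] (suc (toℕ j) + s j * suc (toℕ j))
      ≡⟨ ∑-distrib-+ (λ j → suc (toℕ j)) (λ j → s j * suc (toℕ j)) ⟩
    S₁ + ∑[ j < n ] (s j * suc (toℕ j))
      ≡⟨ cong (_+_ S₁) (sum-cong-≗ {n} (λ j → rank-count j (suc (toℕ j)))) ⟨
    S₁ + ∑[ j < n ] ∑[ a < n ] [ s a < s j ]· suc (toℕ j)
      ≡⟨ cong (_+_ S₁) (∑-comm (λ j a → [ s a < s j ]· suc (toℕ j))) ⟩
    S₁ + ∑[ a < n ] ∑[ b < n ] [ s a < s b ]· suc (toℕ b)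
      ≡⟨ cong (_+_ S₁) ∑∑-rank-weight ⟩
    S₁ + (ninvsum (fun σ) + S₂)
      ≡⟨ cong (_+_ S₁) (+-comm (ninvsum (fun σ)) S₂) ⟩
    S₁ + (S₂ + ninvsum (fun σ))
      ≡⟨ +-assoc S₁ S₂ (ninvsum (fun σ)) ⟨
    S₁ + S₂ + ninvsum (fun σ)
      ≡⟨ cong (_+ ninvsum (fun σ)) (dot-one-oneᶜ n) ⟨
    dot (one {n}) oneᶜ + ninvsum (fun σ)
      ∎
    where
    open ≡-Reasoning
    S₁ S₂ : ℕ
    S₁ = ∑[ j < n ] suc (toℕ j)
    S₂ = ∑[ a < n ] ((n ∸ suc (toℕ a)) * suc (toℕ a))

dot-inv≡dot-compose-one : ∀ {n} (π ρ : Permutation′ n) →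
  dot (fun π) (inv ρ) ≡ dot (compose π ρ) one
dot-inv≡dot-compose-one {n} π ρ = begin
  dot (fun π) (inv ρ)
    ≡⟨ sumFin≡sum (λ i → val (fun π) i * val (inv ρ) i) ⟩
  ∑[ i < n ] (val (fun π) i * val (inv ρ) i)
    ≡⟨ ∑-permute (λ i → val (fun π) i * val (inv ρ) i) ρ ⟩
  ∑[ j < n ] (val (compose π ρ) j * suc (toℕ (ρ ⟨$⟩ˡ (ρ ⟨$⟩ʳ j))))
    ≡⟨ sum-cong-≗ {n} (λ j → cong (λ i → val (compose π ρ) j * suc (toℕ i)) (inverseˡ ρ)) ⟩
  ∑[ j < n ] (val (compose π ρ) j * val one j)
    ≡⟨ sumFin≡sum (λ j → val (compose π ρ) j * val one j) ⟨
  dot (compose π ρ) one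
    ∎
  where open ≡-Reasoning

corollary2p6 : ∀ (n : ℕ) (π ρ : Permutation′ n) →
    + ninvsum (compose π ρ) ≡ + dot (fun π) (inv ρ) - + dot (one {n}) (oneᶜ {n})
corollary2p6 n π ρ = begin
  + N                 ≡⟨ xyx⁻¹≈y (+ D) (+ N) ⟨
  + (D + N) - + D     ≡⟨ cong (λ x → + x - + D) (dot-one≡dot-one-oneᶜ+ninvsum (ρ ∘ₚ π)) ⟨
  + dot (compose π ρ) one - + D
                      ≡⟨ cong (λ x → + x - + D) (dot-inv≡dot-compose-one π ρ) ⟨
  + dot (fun π) (inv ρ) - + D ∎
  where
  open ≡-Reasoning
  N D : ℕ
  N = ninvsum (compose π ρ)
  D = dot (one {n}) oneᶜ
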